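{- Let $D$ be a symmetric $(81,16,3)$ design (if one exists) and let $G$ be a group of automorphisms of $D$. Then $G$ has no element of order $7$ or $11$.
   Context: A symmetric $(v,k,\lambda)$ design, for integers $v>k>\lambda\geq 0$, is a pair $D=(V,\mathcal{B})$ where $V$ is a set of $v$ points and $\mathcal{B}$ is a set of $k$-subsets of $V$ (blocks) such that $|\mathcal{B}|=v$, every point lies in exactly $k$ blocks, any two distinct blocks meet in exactly $\lambda$ points, and any two distinct points lie in exactly $\lambda$ common blocks. An automorphism of $D$ is a permutation of $V$ mapping blocks to blocks; an automorphism group of $D$ is a subgroup of the group of all automorphisms. -}

module Defs where

open import Data.Nat using (ℕ; zero; suc; _<_)
open import Data.Bool using (Bool; _∧_)
open import Data.Fin using (Fin)
open import Data.Fin.Subset using (Subset; _∩_; ∣_∣)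
open import Data.Vec using (lookup; tabulate)
open import Data.Fin.Permutation using (Permutation′; _⟨$⟩ʳ_; _⟨$⟩ˡ_; id; flip; _∘ₚ_)
open import Data.Product using (Σ; _×_)
open import Function.Definitions using (Injective)
open import Relation.Binary.PropositionalEquality using (_≡_; _≢_)
open import Relation.Nullary using (¬_)

-- A symmetric (v,k,λ) design on the point set Fin v.
-- The v blocks are given as an injective (= the blocks are distinct, so the
-- block *set* has exactly v elements) family of subsets of Fin v.
record SymmetricDesign (v k lam : ℕ) : Set where
  field
    v>k       : k < v
    k>lam     : lam < k
    block     : Fin v → Subset v
    distinct  : Injective _≡_ _≡_ block
    blockSize : ∀ b → ∣ block b ∣ ≡ k
    replication : ∀ x → ∣ tabulate (λ b → lookup (block b) x) ∣ ≡ k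
    blockMeet : ∀ b c → b ≢ c → ∣ block b ∩ block c ∣ ≡ lam
    pointPair : ∀ x y → x ≢ y →
      ∣ tabulate (λ b → lookup (block b) x ∧ lookup (block b) y) ∣ ≡ lam

open SymmetricDesign public

image : ∀ {n} → Permutation′ n → Subset n → Subset n
image σ S = tabulate (λ y → lookup S (σ ⟨$⟩ˡ y))

IsAutomorphism : ∀ {v k lam} → SymmetricDesign v k lam → Permutation′ v → Set
IsAutomorphism D σ = ∀ b → Σ (Fin _) (λ c → image σ (block D b) ≡ block D c)

infix 4 _≈ₚ_
infixr 8 _^ₚ_

_≈ₚ_ : ∀ {n} → Permutation′ n → Permutation′ n → Set
σ ≈ₚ τ = ∀ i → σ ⟨$⟩ʳ i ≡ τ ⟨$⟩ʳ i

record AutomorphismGroup {v k lam} (D : SymmetricDesign v k lam) : Set₁ where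
  field
    mem       : Permutation′ v → Set
    respects  : ∀ {σ τ} → σ ≈ₚ τ → mem σ → mem τ
    id∈       : mem id
    ∘∈        : ∀ {σ τ} → mem σ → mem τ → mem (σ ∘ₚ τ)
    inv∈      : ∀ {σ} → mem σ → mem (flip σ)
    automorph : ∀ {σ} → mem σ → IsAutomorphism D σ

open AutomorphismGroup public

_^ₚ_ : ∀ {n} → Permutation′ n → ℕ → Permutation′ n
σ ^ₚ zero  = id
σ ^ₚ suc m = σ ∘ₚ (σ ^ₚ m)

HasOrder : ∀ {n} → Permutation′ n → ℕ → Set
HasOrder σ m = (0 < m) × (σ ^ₚ m ≈ₚ id) × (∀ j → 0 < j → j < m → ¬ (σ ^ₚ j ≈ₚ id))

module Submission where

-- Let σ be an automorphism of prime order p > λ of a symmetric (v,k,λ) design, with f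
-- fixed points, and let u_b be the number of fixed points on block b.  Double counting
-- shows that σ fixes f blocks, that Σ_b u_b = k f and that Σ_b u_b² = f (λ f + k - λ).
-- Orbit counting (moved points fall into orbits of size p) shows that a moved block has
-- u_b ≤ 1, that a fixed block has u_b ≡ k (mod p), and that f ≡ v (mod p).  For (81,16,3)
-- and p ∈ {7, 11} these facts are incompatible: for small f every fixed block carries the
-- one admissible value u_b ≤ f, contradicting the moment identities, and for large f the
-- inequality (u - a)(u - c) ≥ 0 between consecutive admissible values a < c does.

open import Defs
open import Data.Bool using (Bool; true; false; _∧_; _∨_; not)
open import Data.Bool.Properties using (∧-idem; ∧-zeroʳ; ∧-identityʳ)
open import Data.Fin using (Fin; zero; suc; toℕ; fromℕ<)
open import Data.Fin.Properties using (_≟_; any?; all?; toℕ<n; toℕ-fromℕ<; toℕ-injective; suc-injective)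
open import Data.Fin.Subset using (Subset; _∩_; ∣_∣)
open import Data.Fin.Permutation using (Permutation′; _⟨$⟩ʳ_; _⟨$⟩ˡ_; id; inverseˡ; inverseʳ)
open import Data.Nat using (ℕ; zero; suc; pred; _+_; _*_; _∸_; _≤_; _<_; _≰_; _≤?_; _<?_; z≤n; s≤s; NonZero; >-nonZero; >-nonZero⁻¹)
  renaming (_≟_ to _≟ℕ_)
open import Data.Nat.Properties hiding (_≟_; suc-injective)
open import Algebra.Properties.CommutativeSemigroup +-commutativeSemigroup using (x∙yz≈y∙xz)
open import Algebra.Properties.Semiring.Sum +-*-semiring
  using (sum; sum-cong-≗; sum-replicate-zero; ∑-distrib-+; ∑-comm; *-distribˡ-sum; *-distribʳ-sum)
open import Data.Nat.Divisibility using (_∣?_; _∣_; divides; _∣0; ∣-refl; ∣m∣n⇒∣m+n)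
open import Data.Nat.Coprimality using (Coprime; coprime-Bézout; prime⇒coprime)
open import Data.Nat.GCD using (module Bézout)
open import Data.Nat.Primality using (Prime; prime?; prime⇒nonZero)
open import Data.Nat.Tactic.RingSolver using (solve-∀)
open import Data.Product using (∃-syntax; _×_; _,_; proj₁; proj₂)
open import Data.Vec using ([]; _∷_; lookup; tabulate)
open import Data.Vec.Properties using (lookup∘tabulate; lookup-zipWith; tabulate∘lookup; tabulate-cong)
open import Function using (_∘_; mk⇔)
open import Data.Empty using (⊥; ⊥-elim)
open import Data.Sum using ([_,_]′)
open import Relation.Binary.PropositionalEquality
open import Relation.Binary.Definitions using (tri<; tri≈; tri>)
open import Relation.Nullary using (¬_; Dec; yes; no; _because_; does; contradiction)
open import Relation.Nullary.Decidable using (from-yes; from-no; True; dec-true; does-⇔; toWitness; ¬?; _→-dec_)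
open import Relation.Nullary.Reflects using (invert)
open ≡-Reasoning

χ : Bool → ℕ
χ true  = 1
χ false = 0

count : ∀ {n} → (Fin n → Bool) → ℕ
count P = sum (λ i → χ (P i))

δ : ∀ {n} → Fin n → Fin n → ℕ
δ x y = χ (does (x ≟ y))

witness : ∀ {A : Set} (a? : Dec A) → does a? ≡ true → A
witness (true because [a]) _ = invert [a]

∧-split : ∀ {a b} → a ∧ b ≡ true → a ≡ true × b ≡ true
∧-split {true} {true} _ = refl , refl

∧-absorb : ∀ {a b} → (b ≡ true → a ≡ true) → a ∧ b ≡ b
∧-absorb {a} {false} _ = ∧-zeroʳ a
∧-absorb {a} {true}  b⇒a = trans (∧-identityʳ a) (b⇒a refl)

not-elim : ∀ {b} → not b ≡ true → b ≢ true
not-elim {false} _ ()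

not-intro : ∀ {b} → b ≢ true → not b ≡ true
not-intro {true}  b≢true = contradiction refl b≢true
not-intro {false} _      = refl

χ-∧ : ∀ a b → χ (a ∧ b) ≡ χ a * χ b
χ-∧ true  b = sym (+-identityʳ (χ b))
χ-∧ false b = refl

χ-idem : ∀ a → χ a * χ a ≡ χ a
χ-idem true  = refl
χ-idem false = refl

sum-mono : ∀ {n} {g h : Fin n → ℕ} → (∀ i → g i ≤ h i) → sum g ≤ sum h
sum-mono {zero}  _   = z≤n
sum-mono {suc n} g≤h = +-mono-≤ (g≤h zero) (sum-mono (g≤h ∘ suc))

sum-δ : ∀ {n} (x : Fin n) (g : Fin n → ℕ) → sum (λ y → δ x y * g y) ≡ g x
sum-δ {suc n} zero g = begin
  1 * g zero + sum {n} (λ _ → 0) ≡⟨ cong₂ _+_ (*-identityˡ (g zero)) (sum-replicate-zero n) ⟩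
  g zero + 0                     ≡⟨ +-identityʳ (g zero) ⟩
  g zero                         ∎
sum-δ {suc n} (suc x) g = sum-δ x (g ∘ suc)

sum-split : ∀ {n} (c : Fin n → Bool) (g : Fin n → ℕ) →
  sum g ≡ sum (λ i → χ (c i) * g i) + sum (λ i → χ (not (c i)) * g i)
sum-split c g = trans (sum-cong-≗ (λ i → split (c i) (g i)))
  (∑-distrib-+ (λ i → χ (c i) * g i) (λ i → χ (not (c i)) * g i))
  where
  split : ∀ b m → m ≡ χ b * m + χ (not b) * m
  split true  m = sym (trans (+-identityʳ (m + 0)) (+-identityʳ m))
  split false m = sym (+-identityʳ m)

count-cong : ∀ {n} {P Q : Fin n → Bool} → (∀ i → P i ≡ Q i) → count P ≡ count Q
count-cong P≗Q = sum-cong-≗ (cong χ ∘ P≗Q)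

count-mono : ∀ {n} {P Q : Fin n → Bool} → (∀ i → P i ≡ true → Q i ≡ true) → count P ≤ count Q
count-mono {P = P} {Q} P⊆Q = sum-mono (λ i → χ-mono (P i) (Q i) (P⊆Q i))
  where
  χ-mono : ∀ a b → (a ≡ true → b ≡ true) → χ a ≤ χ b
  χ-mono true  b a⇒b rewrite a⇒b refl = ≤-refl
  χ-mono false b _   = z≤n

count-split : ∀ {n} (P Q : Fin n → Bool) →
  count P ≡ count (λ i → P i ∧ Q i) + count (λ i → P i ∧ not (Q i))
count-split P Q = trans (sum-cong-≗ (λ i → split (P i) (Q i)))
  (∑-distrib-+ (λ i → χ (P i ∧ Q i)) (λ i → χ (P i ∧ not (Q i))))
  where
  split : ∀ a b → χ a ≡ χ (a ∧ b) + χ (a ∧ not b)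
  split true  true  = refl
  split true  false = refl
  split false b     = refl

count-all : ∀ {n} → count {n} (λ _ → true) ≡ n
count-all {zero}  = refl
count-all {suc n} = cong suc (count-all {n})

count-compl : ∀ {n} (P : Fin n → Bool) → count P + count (not ∘ P) ≡ n
count-compl P = sym (trans (sym count-all) (count-split (λ _ → true) P))

count-pos : ∀ {n} {P : Fin n → Bool} (x : Fin n) → P x ≡ true → 0 < count P
count-pos {P = P} zero    Px rewrite Px = s≤s z≤n
count-pos {P = P} (suc x) Px = ≤-trans (count-pos {P = P ∘ suc} x Px) (m≤n+m _ (χ (P zero)))

count-witness : ∀ {n} (P : Fin n → Bool) → 0 < count P → ∃[ x ] P x ≡ true
count-witness {suc n} P pos with P zero in P0
... | true  = zero , P0
... | false = let (x , Px) = count-witness (P ∘ suc) pos in suc x , Px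

count-δ : ∀ {n} (x : Fin n) → count (λ y → does (x ≟ y)) ≡ 1
count-δ x = trans (sum-cong-≗ (λ y → sym (*-identityʳ (δ x y)))) (sum-δ x (λ _ → 1))

count-≤1 : ∀ {n} (P : Fin n → Bool) → (∀ x y → P x ≡ true → P y ≡ true → x ≡ y) → count P ≤ 1
count-≤1 P unique with 0 <? count P
... | no  empty = ≤-trans (≮⇒≥ empty) z≤n
... | yes nonempty = let (x , Px) = count-witness P nonempty in
  subst (count P ≤_) (count-δ x) (count-mono (λ y Py → dec-true (x ≟ y) (unique x y Px Py)))

count-∧ : ∀ {n} (P Q : Fin n → Bool) → count (λ i → P i ∧ Q i) ≡ sum (λ i → χ (P i) * χ (Q i))
count-∧ P Q = sum-cong-≗ (λ i → χ-∧ (P i) (Q i))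

size-count : ∀ {n} (S : Subset n) → ∣ S ∣ ≡ count (lookup S)
size-count []          = refl
size-count (true ∷ S)  = cong suc (size-count S)
size-count (false ∷ S) = size-count S

size-tabulate : ∀ {n} (P : Fin n → Bool) → ∣ tabulate P ∣ ≡ count P
size-tabulate P = trans (size-count (tabulate P)) (count-cong (lookup∘tabulate P))

size-∩ : ∀ {n} (S T : Subset n) → ∣ S ∩ T ∣ ≡ count (λ i → lookup S i ∧ lookup T i)
size-∩ S T = trans (size-count (S ∩ T)) (count-cong (λ i → lookup-zipWith _∧_ i S T))

subset-ext : ∀ {n} {S T : Subset n} → (∀ i → lookup S i ≡ lookup T i) → S ≡ T
subset-ext {S = S} {T} S≗T = trans (sym (tabulate∘lookup S)) (trans (tabulate-cong S≗T) (tabulate∘lookup T))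

image-count : ∀ {m n} (g : Fin m → Fin n) → (∀ i j → g i ≡ g j → i ≡ j) →
  count (λ y → does (any? (λ i → g i ≟ y))) ≡ m
image-count {zero}  {n} g inj = sum-replicate-zero n
image-count {suc m} {n} g inj = begin
  count (λ y → does (g zero ≟ y) ∨ does (any? (λ i → g (suc i) ≟ y)))
    ≡⟨ sum-cong-≗ (λ y → χ-∨ (g zero ≟ y) (any? (λ i → g (suc i) ≟ y)) (disjoint y)) ⟩
  sum (λ y → δ (g zero) y + χ (does (any? (λ i → g (suc i) ≟ y))))
    ≡⟨ ∑-distrib-+ (λ y → δ (g zero) y) (λ y → χ (does (any? (λ i → g (suc i) ≟ y)))) ⟩
  count (λ y → does (g zero ≟ y)) + count (λ y → does (any? (λ i → g (suc i) ≟ y)))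
    ≡⟨ cong₂ _+_ (count-δ (g zero)) (image-count (g ∘ suc) (λ i j e → suc-injective (inj (suc i) (suc j) e))) ⟩
  suc m ∎
  where
  χ-∨ : ∀ {A B : Set} (a? : Dec A) (b? : Dec B) → (A → B → ⊥) → χ (does a? ∨ does b?) ≡ χ (does a?) + χ (does b?)
  χ-∨ (true because [a]) (true because [b]) disj = ⊥-elim (disj (invert [a]) (invert [b]))
  χ-∨ (true because _) (false because _) _ = refl
  χ-∨ (false because _) b? _ = refl
  disjoint : ∀ y → g zero ≡ y → ∃[ i ] g (suc i) ≡ y → ⊥
  disjoint y g0≡y (i , gi≡y) with inj zero (suc i) (trans g0≡y (sym gi≡y))
  ... | ()

iter : ∀ {A : Set} → (A → A) → ℕ → A → A
iter h zero    x = x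
iter h (suc k) x = h (iter h k x)

iter-+ : ∀ {A : Set} (h : A → A) a b x → iter h (a + b) x ≡ iter h a (iter h b x)
iter-+ h zero    b x = refl
iter-+ h (suc a) b x = cong h (iter-+ h a b x)

iter-comm : ∀ {A : Set} (h : A → A) k x → iter h k (h x) ≡ h (iter h k x)
iter-comm h zero    x = refl
iter-comm h (suc k) x = cong h (iter-comm h k x)

iter-* : ∀ {A : Set} (h : A → A) j x → iter h j x ≡ x → ∀ c → iter h (c * j) x ≡ x
iter-* h j x ret zero    = refl
iter-* h j x ret (suc c) = begin
  iter h (j + c * j) x     ≡⟨ iter-+ h j (c * j) x ⟩
  iter h j (iter h (c * j) x) ≡⟨ cong (iter h j) (iter-* h j x ret c) ⟩
  iter h j x               ≡⟨ ret ⟩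
  x                        ∎

-- A point returning after a steps and after b steps, with a and b coprime,
-- is fixed: by Bézout one step is a difference of multiples of a and b.
coprime-returns-fix : ∀ {A : Set} (h : A → A) {a b} x →
  iter h a x ≡ x → iter h b x ≡ x → Coprime a b → h x ≡ x
coprime-returns-fix h {a} {b} x ret-a ret-b a⊥b with coprime-Bézout a⊥b
... | Bézout.+- c d 1+db≡ca = begin
  h x                    ≡⟨ cong h (sym (iter-* h b x ret-b d)) ⟩
  iter h (1 + d * b) x   ≡⟨ cong (λ m → iter h m x) 1+db≡ca ⟩
  iter h (c * a) x       ≡⟨ iter-* h a x ret-a c ⟩
  x                      ∎
... | Bézout.-+ c d 1+ca≡db = begin
  h x                    ≡⟨ cong h (sym (iter-* h a x ret-a c)) ⟩
  iter h (1 + c * a) x   ≡⟨ cong (λ m → iter h m x) 1+ca≡db ⟩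
  iter h (d * b) x       ≡⟨ iter-* h b x ret-b d ⟩
  x                      ∎

isFixed : ∀ {n} → (Fin n → Fin n) → Fin n → Bool
isFixed h x = does (h x ≟ x)

fixed-sound : ∀ {n} (h : Fin n → Fin n) x → isFixed h x ≡ true → h x ≡ x
fixed-sound h x = witness (h x ≟ x)

moved-sound : ∀ {n} (h : Fin n → Fin n) x → not (isFixed h x) ≡ true → h x ≢ x
moved-sound h x moved = not-elim moved ∘ dec-true (h x ≟ x)

module Orbits {n} (h : Fin n → Fin n) {p} (p-prime : Prime p) (period : ∀ x → iter h p x ≡ x) where

  instance
    p≢0 : NonZero p
    p≢0 = prime⇒nonZero p-prime

  early-return-fix : ∀ x j → 0 < j → j < p → iter h j x ≡ x → h x ≡ x
  early-return-fix x (suc j) _ j<p ret =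
    coprime-returns-fix h x (period x) ret (prime⇒coprime p-prime j<p)

  h⁻¹-h : ∀ y → iter h (pred p) (h y) ≡ y
  h⁻¹-h y = trans (iter-comm h (pred p) y) (trans (cong (λ m → iter h m y) (suc-pred p)) (period y))

  h-injective : ∀ a b → h a ≡ h b → a ≡ b
  h-injective a b ha≡hb = trans (sym (h⁻¹-h a)) (trans (cong (iter h (pred p)) ha≡hb) (h⁻¹-h b))

  iter-injective : ∀ k a b → iter h k a ≡ iter h k b → a ≡ b
  iter-injective zero    a b eq = eq
  iter-injective (suc k) a b eq = iter-injective k a b (h-injective _ _ eq)

  Invariant : (Fin n → Bool) → Set
  Invariant S = ∀ x → S x ≡ true → S (h x) ≡ true

  moved-invariant : Invariant (not ∘ isFixed h)
  moved-invariant x moved =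
    not-intro (moved-sound h x moved ∘ h-injective (h x) x ∘ fixed-sound h (h x))

  orbit : Fin n → Fin n → Bool
  orbit x y = does (any? (λ (i : Fin p) → iter h (toℕ i) x ≟ y))

  orbit-elim : ∀ x y → orbit x y ≡ true → ∃[ i ] i < p × iter h i x ≡ y
  orbit-elim x y y∈ = let (i , hⁱx≡y) = witness (any? (λ (i : Fin p) → iter h (toℕ i) x ≟ y)) y∈
                      in toℕ i , toℕ<n i , hⁱx≡y

  orbit-intro : ∀ x i → i < p → orbit x (iter h i x) ≡ true
  orbit-intro x i i<p = dec-true (any? (λ (j : Fin p) → iter h (toℕ j) x ≟ iter h i x))
    (fromℕ< i<p , cong (λ m → iter h m x) (toℕ-fromℕ< i<p))

  orbit-pred : ∀ x y → orbit x (h y) ≡ true → orbit x y ≡ true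
  orbit-pred x y hy∈ with orbit-elim x (h y) hy∈
  ... | zero , _ , x≡hy = subst (λ z → orbit x z ≡ true)
          (trans (cong (iter h (pred p)) x≡hy) (h⁻¹-h y))
          (orbit-intro x (pred p) (subst (pred p <_) (suc-pred p) (n<1+n (pred p))))
  ... | suc i , i+1<p , hⁱ⁺¹x≡hy = subst (λ z → orbit x z ≡ true)
          (h-injective _ _ hⁱ⁺¹x≡hy) (orbit-intro x i (<-trans (n<1+n i) i+1<p))

  orbit-⊆ : ∀ S → Invariant S → ∀ x → S x ≡ true → ∀ y → orbit x y ≡ true → S y ≡ true
  orbit-⊆ S inv x Sx y y∈ = let (i , _ , hⁱx≡y) = orbit-elim x y y∈ in subst (λ z → S z ≡ true) hⁱx≡y (reach i)
    where
    reach : ∀ i → S (iter h i x) ≡ true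
    reach zero    = Sx
    reach (suc i) = inv _ (reach i)

  no-early-collision : ∀ x → h x ≢ x → ∀ a b → a < b → b < p → iter h a x ≢ iter h b x
  no-early-collision x moved a b a<b b<p hᵃx≡hᵇx = moved (iter-injective a (h x) x (begin
    iter h a (h x)  ≡⟨ iter-comm h a x ⟩
    h (iter h a x)  ≡⟨ early-return-fix (iter h a x) (b ∸ a) (m<n⇒0<n∸m a<b) (≤-<-trans (m∸n≤m b a) b<p) (sym returns) ⟩
    iter h a x      ∎))
    where
    returns : iter h a x ≡ iter h (b ∸ a) (iter h a x)
    returns = begin
      iter h a x              ≡⟨ hᵃx≡hᵇx ⟩
      iter h b x              ≡⟨ cong (λ m → iter h m x) (sym (m∸n+n≡m (<⇒≤ a<b))) ⟩
      iter h (b ∸ a + a) x    ≡⟨ iter-+ h (b ∸ a) a x ⟩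
      iter h (b ∸ a) (iter h a x) ∎

  orbit-size : ∀ x → h x ≢ x → count (orbit x) ≡ p
  orbit-size x moved = image-count (λ i → iter h (toℕ i) x)
    (λ i j eq → toℕ-injective (exponents-equal (toℕ i) (toℕ j) (toℕ<n i) (toℕ<n j) eq))
    where
    exponents-equal : ∀ a b → a < p → b < p → iter h a x ≡ iter h b x → a ≡ b
    exponents-equal a b a<p b<p eq with <-cmp a b
    ... | tri< a<b _ _ = contradiction eq (no-early-collision x moved a b a<b b<p)
    ... | tri≈ _ a≡b _ = a≡b
    ... | tri> _ _ b<a = contradiction (sym eq) (no-early-collision x moved b a b<a a<p)

  orbit-≤ : ∀ S → Invariant S → ∀ x → S x ≡ true → h x ≢ x → p ≤ count S
  orbit-≤ S inv x Sx moved = subst (_≤ count S) (orbit-size x moved) (count-mono (orbit-⊆ S inv x Sx))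

  -- An invariant set of moved points is a disjoint union of orbits, so p divides its size.
  moved-divisible : ∀ S → Invariant S → (∀ x → S x ≡ true → h x ≢ x) → p ∣ count S
  moved-divisible S = by-size (count S) S ≤-refl
    where
    by-size : ∀ bound S → count S ≤ bound → Invariant S → (∀ x → S x ≡ true → h x ≢ x) → p ∣ count S
    by-size bound S size inv moved with 0 <? count S
    ... | no empty = subst (p ∣_) (sym (n≤0⇒n≡0 (≮⇒≥ empty))) (p ∣0)
    by-size zero S size inv moved | yes nonempty = contradiction size (<⇒≱ nonempty)
    by-size (suc bound) S size inv moved | yes nonempty = subst (p ∣_) (sym split) (∣m∣n⇒∣m+n ∣-refl
      (by-size bound rest rest-size rest-inv (λ y rest-y → moved y (proj₁ (∧-split rest-y)))))
      where
      x : Fin n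
      x = proj₁ (count-witness S nonempty)
      Sx : S x ≡ true
      Sx = proj₂ (count-witness S nonempty)
      rest : Fin n → Bool
      rest y = S y ∧ not (orbit x y)
      split : count S ≡ p + count rest
      split = trans (count-split S (orbit x))
        (cong (_+ count rest) (trans (count-cong (λ y → ∧-absorb (orbit-⊆ S inv x Sx y))) (orbit-size x (moved x Sx))))
      rest-size : count rest ≤ bound
      rest-size = ≤-pred (≤-trans (+-monoˡ-≤ (count rest) (>-nonZero⁻¹ p)) (subst (_≤ suc bound) split size))
      rest-inv : Invariant rest
      rest-inv y rest-y = let (Sy , y∉) = ∧-split rest-y in
        cong₂ _∧_ (inv y Sy) (not-intro (not-elim y∉ ∘ orbit-pred x y))

  moved-part-divisible : ∀ S → Invariant S → p ∣ count (λ x → S x ∧ not (isFixed h x))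
  moved-part-divisible S inv = moved-divisible (λ x → S x ∧ not (isFixed h x))
    (λ x Sx∧moved → let (Sx , moved) = ∧-split Sx∧moved in cong₂ _∧_ (inv x Sx) (moved-invariant x moved))
    (λ x Sx∧moved → moved-sound h x (proj₂ (∧-split Sx∧moved)))

first-moment : ∀ {m n} (a : Fin m → Fin n → ℕ) (w : Fin n → ℕ) →
  sum (λ b → sum (λ x → w x * a b x)) ≡ sum (λ x → w x * sum (λ b → a b x))
first-moment a w = trans (∑-comm (λ b x → w x * a b x)) (sum-cong-≗ (λ x → sym (*-distribˡ-sum (w x) (λ b → a b x))))

second-moment : ∀ {m n} (a : Fin m → Fin n → ℕ) (w : Fin n → ℕ) →
  let r = λ b → sum (λ x → w x * a b x) in
  sum (λ b → r b * r b) ≡ sum (λ x → sum (λ y → w x * w y * sum (λ b → a b x * a b y)))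
second-moment {m} {n} a w = begin
  sum (λ b → r b * r b)
    ≡⟨ sum-cong-≗ square ⟩
  sum (λ b → sum (λ x → sum (λ y → term b x y)))
    ≡⟨ ∑-comm (λ b x → sum (λ y → term b x y)) ⟩
  sum (λ x → sum (λ b → sum (λ y → term b x y)))
    ≡⟨ sum-cong-≗ (λ x → ∑-comm (λ b y → term b x y)) ⟩
  sum (λ x → sum (λ y → sum (λ b → term b x y)))
    ≡⟨ sum-cong-≗ (λ x → sum-cong-≗ (λ y → pull-weights x y)) ⟩
  sum (λ x → sum (λ y → w x * w y * sum (λ b → a b x * a b y))) ∎
  where
  r : Fin m → ℕ
  r b = sum (λ x → w x * a b x)
  term : Fin m → Fin n → Fin n → ℕ
  term b x y = w x * a b x * (w y * a b y)
  square : ∀ b → r b * r b ≡ sum (λ x → sum (λ y → term b x y))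
  square b = trans (*-distribʳ-sum (r b) (λ x → w x * a b x))
                   (sum-cong-≗ (λ x → *-distribˡ-sum (w x * a b x) (λ y → w y * a b y)))
  pull-weights : ∀ x y → sum (λ b → term b x y) ≡ w x * w y * sum (λ b → a b x * a b y)
  pull-weights x y = trans (sum-cong-≗ (λ b → rearrange (w x) (a b x) (w y) (a b y)))
                           (sym (*-distribˡ-sum (w x * w y) (λ b → a b x * a b y)))
    where
    rearrange : ∀ s t u z → s * t * (u * z) ≡ s * u * (t * z)
    rearrange = solve-∀

δ-form : ∀ {n} (P : Fin n → Bool) lam c →
  sum (λ x → sum (λ y → χ (P x) * χ (P y) * (lam + c * δ x y))) ≡ count P * (lam * count P + c)
δ-form P lam c = trans (sum-cong-≗ row) (sym (*-distribʳ-sum (lam * count P + c) (λ x → χ (P x))))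
  where
  f : ℕ
  f = count P
  expand : ∀ s t l c d → s * t * (l + c * d) ≡ s * l * t + c * s * (d * t)
  expand = solve-∀
  row : ∀ x → sum (λ y → χ (P x) * χ (P y) * (lam + c * δ x y)) ≡ χ (P x) * (lam * f + c)
  row x = begin
    sum (λ y → χ (P x) * χ (P y) * (lam + c * δ x y))
      ≡⟨ sum-cong-≗ (λ y → expand (χ (P x)) (χ (P y)) lam c (δ x y)) ⟩
    sum (λ y → χ (P x) * lam * χ (P y) + c * χ (P x) * (δ x y * χ (P y)))
      ≡⟨ ∑-distrib-+ (λ y → χ (P x) * lam * χ (P y)) (λ y → c * χ (P x) * (δ x y * χ (P y))) ⟩
    sum (λ y → χ (P x) * lam * χ (P y)) + sum (λ y → c * χ (P x) * (δ x y * χ (P y)))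
      ≡⟨ cong₂ _+_ (sym (*-distribˡ-sum (χ (P x) * lam) (λ y → χ (P y))))
                   (trans (sym (*-distribˡ-sum (c * χ (P x)) (λ y → δ x y * χ (P y))))
                          (cong (c * χ (P x) *_) (sum-δ x (λ y → χ (P y))))) ⟩
    χ (P x) * lam * f + c * χ (P x) * χ (P x)
      ≡⟨ cong (χ (P x) * lam * f +_) (trans (*-assoc c (χ (P x)) (χ (P x))) (cong (c *_) (χ-idem (P x)))) ⟩
    χ (P x) * lam * f + c * χ (P x)
      ≡⟨ factor (χ (P x)) lam f c ⟩
    χ (P x) * (lam * f + c) ∎
    where
    factor : ∀ s l f c → s * l * f + c * s ≡ s * (l * f + c)
    factor = solve-∀

module Incidence {v k lam} (D : SymmetricDesign v k lam) where

  inc : Fin v → Fin v → Bool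
  inc b x = lookup (block D b) x

  block-size : ∀ b → count (inc b) ≡ k
  block-size b = trans (sym (size-count (block D b))) (blockSize D b)

  point-degree : ∀ x → count (λ b → inc b x) ≡ k
  point-degree x = trans (sym (size-tabulate (λ b → inc b x))) (replication D x)

  diagonal-form : (c : Fin v → Fin v → ℕ) → (∀ x → c x x ≡ k) → (∀ x y → x ≢ y → c x y ≡ lam) →
    ∀ x y → c x y ≡ lam + (k ∸ lam) * δ x y
  diagonal-form c diag off x y with x ≟ y
  ... | yes refl = begin
    c x x                        ≡⟨ diag x ⟩
    k                            ≡⟨ sym (m+[n∸m]≡n (<⇒≤ (k>lam D))) ⟩
    lam + (k ∸ lam)              ≡⟨ cong (lam +_) (*-identityʳ (k ∸ lam)) ⟨
    lam + (k ∸ lam) * 1          ∎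
  ... | no x≢y = begin
    c x y                        ≡⟨ off x y x≢y ⟩
    lam                          ≡⟨ sym (+-identityʳ lam) ⟩
    lam + 0                      ≡⟨ cong (lam +_) (*-zeroʳ (k ∸ lam)) ⟨
    lam + (k ∸ lam) * 0          ∎

  blocks-meet : ∀ b c → sum (λ x → χ (inc b x) * χ (inc c x)) ≡ lam + (k ∸ lam) * δ b c
  blocks-meet = diagonal-form (λ b c → sum (λ x → χ (inc b x) * χ (inc c x)))
    (λ b → trans (sym (count-∧ (inc b) (inc b))) (trans (count-cong (λ x → ∧-idem (inc b x))) (block-size b)))
    (λ b c b≢c → trans (sym (count-∧ (inc b) (inc c))) (trans (sym (size-∩ (block D b) (block D c))) (blockMeet D b c b≢c)))

  blocks-through : ∀ x y → x ≢ y → count (λ b → inc b x ∧ inc b y) ≡ lam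
  blocks-through x y x≢y = trans (sym (size-tabulate (λ b → inc b x ∧ inc b y))) (pointPair D x y x≢y)

  points-join : ∀ x y → sum (λ b → χ (inc b x) * χ (inc b y)) ≡ lam + (k ∸ lam) * δ x y
  points-join = diagonal-form (λ x y → sum (λ b → χ (inc b x) * χ (inc b y)))
    (λ x → trans (sym (count-∧ (λ b → inc b x) (λ b → inc b x))) (trans (count-cong (λ b → ∧-idem (inc b x))) (point-degree x)))
    (λ x y x≢y → trans (sym (count-∧ (λ b → inc b x) (λ b → inc b y))) (blocks-through x y x≢y))

module Automorphism {v k lam} (D : SymmetricDesign v k lam) (σ : Permutation′ v) (aut : IsAutomorphism D σ) where
  open Incidence D

  s β : Fin v → Fin v
  s x = σ ⟨$⟩ʳ x
  β b = proj₁ (aut b)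

  inc-β⁻¹ : ∀ b x → inc (β b) x ≡ inc b (σ ⟨$⟩ˡ x)
  inc-β⁻¹ b x = trans (cong (λ B → lookup B x) (sym (proj₂ (aut b))))
                      (lookup∘tabulate (λ y → inc b (σ ⟨$⟩ˡ y)) x)

  inc-β : ∀ b x → inc (β b) (s x) ≡ inc b x
  inc-β b x = trans (inc-β⁻¹ b (s x)) (cong (inc b) (inverseˡ σ))

  iter-inc : ∀ j b x → inc (iter β j b) (iter s j x) ≡ inc b x
  iter-inc zero    b x = refl
  iter-inc (suc j) b x = trans (inc-β (iter β j b) (iter s j x)) (iter-inc j b x)

  power : ∀ j x → (σ ^ₚ j) ⟨$⟩ʳ x ≡ iter s j x
  power zero    x = refl
  power (suc j) x = trans (power j (s x)) (iter-comm s j x)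

  -- A power of σ fixing every point fixes every block, as blocks are distinct.
  block-period : ∀ j → (∀ x → iter s j x ≡ x) → ∀ b → iter β j b ≡ b
  block-period j ret b = distinct D (subset-ext (λ x →
    trans (cong (inc (iter β j b)) (sym (ret x))) (iter-inc j b x)))

  fixed-point-δ : ∀ x → δ x (σ ⟨$⟩ˡ x) ≡ χ (isFixed s x)
  fixed-point-δ x = cong χ (does-⇔ (mk⇔ (λ x≡σ⁻¹x → trans (cong s x≡σ⁻¹x) (inverseʳ σ))
                                         (λ sx≡x → trans (sym (inverseˡ σ)) (cong (σ ⟨$⟩ˡ_) sx≡x)))
                                    (x ≟ σ ⟨$⟩ˡ x) (s x ≟ x))

  fixed-block-δ : ∀ b → δ b (β b) ≡ χ (isFixed β b)
  fixed-block-δ b = cong χ (does-⇔ (mk⇔ sym sym) (b ≟ β b) (β b ≟ b))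

  -- σ fixes as many blocks as points: count the pairs (x, b) with x ∈ b and x ∈ βb
  -- by points, Σₓ (lam + (k-lam)[σx = x]), and by blocks, Σ_b (lam + (k-lam)[βb = b]).
  fixed-points≡fixed-blocks : count (isFixed s) ≡ count (isFixed β)
  fixed-points≡fixed-blocks = *-cancelˡ-≡ _ _ (k ∸ lam) (+-cancelˡ-≡ (sum {v} (λ _ → lam)) _ _ (begin
    sum {v} (λ _ → lam) + (k ∸ lam) * count (isFixed s)  ≡⟨ affine (isFixed s) ⟨
    sum (λ x → lam + (k ∸ lam) * χ (isFixed s x))        ≡⟨ sum-cong-≗ by-point ⟩
    sum (λ x → sum (λ b → incident-pair b x))            ≡⟨ ∑-comm (λ b x → incident-pair b x) ⟨
    sum (λ b → sum (λ x → incident-pair b x))            ≡⟨ sum-cong-≗ by-block ⟩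
    sum (λ b → lam + (k ∸ lam) * χ (isFixed β b))        ≡⟨ affine (isFixed β) ⟩
    sum {v} (λ _ → lam) + (k ∸ lam) * count (isFixed β)  ∎))
    where
    instance
      k-lam≢0 : NonZero (k ∸ lam)
      k-lam≢0 = >-nonZero (m<n⇒0<n∸m (k>lam D))
    incident-pair : Fin v → Fin v → ℕ
    incident-pair b x = χ (inc b x) * χ (inc (β b) x)
    affine : (P : Fin v → Bool) → sum (λ x → lam + (k ∸ lam) * χ (P x)) ≡ sum {v} (λ _ → lam) + (k ∸ lam) * count P
    affine P = trans (∑-distrib-+ (λ _ → lam) (λ x → (k ∸ lam) * χ (P x)))
                     (cong (sum {v} (λ _ → lam) +_) (sym (*-distribˡ-sum (k ∸ lam) (λ x → χ (P x)))))
    by-point : ∀ x → lam + (k ∸ lam) * χ (isFixed s x) ≡ sum (λ b → incident-pair b x)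
    by-point x = begin
      lam + (k ∸ lam) * χ (isFixed s x)                          ≡⟨ cong (λ d → lam + (k ∸ lam) * d) (fixed-point-δ x) ⟨
      lam + (k ∸ lam) * δ x (σ ⟨$⟩ˡ x)                           ≡⟨ points-join x (σ ⟨$⟩ˡ x) ⟨
      sum (λ b → χ (inc b x) * χ (inc b (σ ⟨$⟩ˡ x)))              ≡⟨ sum-cong-≗ (λ b → cong (λ t → χ (inc b x) * χ t) (inc-β⁻¹ b x)) ⟨
      sum (λ b → incident-pair b x)                              ∎
    by-block : ∀ b → sum (λ x → incident-pair b x) ≡ lam + (k ∸ lam) * χ (isFixed β b)
    by-block b = trans (blocks-meet b (β b)) (cong (λ d → lam + (k ∸ lam) * d) (fixed-block-δ b))

  f : ℕ
  f = count (isFixed s)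

  fixed-on : Fin v → ℕ
  fixed-on b = count (λ x → inc b x ∧ isFixed s x)

  fixed-on-sum : ∀ b → fixed-on b ≡ sum (λ x → χ (isFixed s x) * χ (inc b x))
  fixed-on-sum b = trans (count-∧ (inc b) (isFixed s)) (sum-cong-≗ (λ x → *-comm (χ (inc b x)) (χ (isFixed s x))))

  -- Each fixed point lies on k blocks.
  sum-fixed-on : sum fixed-on ≡ k * f
  sum-fixed-on = begin
    sum fixed-on                                              ≡⟨ sum-cong-≗ fixed-on-sum ⟩
    sum (λ b → sum (λ x → χ (isFixed s x) * χ (inc b x)))     ≡⟨ first-moment (λ b x → χ (inc b x)) (λ x → χ (isFixed s x)) ⟩
    sum (λ x → χ (isFixed s x) * count (λ b → inc b x))       ≡⟨ sum-cong-≗ (λ x → cong (χ (isFixed s x) *_) (point-degree x)) ⟩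
    sum (λ x → χ (isFixed s x) * k)                           ≡⟨ *-distribʳ-sum k (λ x → χ (isFixed s x)) ⟨
    f * k                                                     ≡⟨ *-comm f k ⟩
    k * f                                                     ∎

  -- Two distinct fixed points lie on lam common blocks, a fixed point on k.
  sum-fixed-on² : sum (λ b → fixed-on b * fixed-on b) ≡ f * (lam * f + (k ∸ lam))
  sum-fixed-on² = begin
    sum (λ b → fixed-on b * fixed-on b)
      ≡⟨ sum-cong-≗ (λ b → cong₂ _*_ (fixed-on-sum b) (fixed-on-sum b)) ⟩
    sum (λ b → sum (λ x → χ (isFixed s x) * χ (inc b x)) * sum (λ x → χ (isFixed s x) * χ (inc b x)))
      ≡⟨ second-moment (λ b x → χ (inc b x)) (λ x → χ (isFixed s x)) ⟩
    sum (λ x → sum (λ y → χ (isFixed s x) * χ (isFixed s y) * sum (λ b → χ (inc b x) * χ (inc b y))))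
      ≡⟨ sum-cong-≗ (λ x → sum-cong-≗ (λ y → cong (χ (isFixed s x) * χ (isFixed s y) *_) (points-join x y))) ⟩
    sum (λ x → sum (λ y → χ (isFixed s x) * χ (isFixed s y) * (lam + (k ∸ lam) * δ x y)))
      ≡⟨ δ-form (isFixed s) lam (k ∸ lam) ⟩
    f * (lam * f + (k ∸ lam)) ∎

-- s is a possible number of fixed points on a fixed block: s ≡ k (mod p) and s ≤ k.
Admissible : ℕ → ℕ → ℕ → Set
Admissible p k s = ∃[ q ] q * p + s ≡ k

module PrimeOrder {v k lam} (D : SymmetricDesign v k lam) (σ : Permutation′ v) (aut : IsAutomorphism D σ)
  {p} (p-prime : Prime p) (lam<p : lam < p) (σᵖ≈id : σ ^ₚ p ≈ₚ id) where
  open Incidence D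
  open Automorphism D σ aut public

  point-period : ∀ x → iter s p x ≡ x
  point-period x = trans (sym (power p x)) (σᵖ≈id x)

  module Points = Orbits s p-prime point-period
  module Blocks = Orbits β p-prime (block-period p point-period)

  inc-β-fixed : ∀ c x → s x ≡ x → inc (β c) x ≡ inc c x
  inc-β-fixed c x sx≡x = trans (cong (inc (β c)) (sym sx≡x)) (inc-β c x)

  -- A moved block contains at most one fixed point: the lam blocks through two fixed
  -- points form a β-invariant set, too small (lam < p) to contain a moved block.
  moved-block : ∀ b → isFixed β b ≡ false → fixed-on b ≤ 1
  moved-block b b-moved = count-≤1 (λ x → inc b x ∧ isFixed s x) unique
    where
    unique : ∀ x y → (inc b x ∧ isFixed s x) ≡ true → (inc b y ∧ isFixed s y) ≡ true → x ≡ y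
    unique x y x-fixed-on-b y-fixed-on-b with x ≟ y
    ... | yes x≡y = x≡y
    ... | no  x≢y = contradiction (subst (p ≤_) (blocks-through x y x≢y) too-large) (<⇒≱ lam<p)
      where
      x∈b : inc b x ≡ true
      x∈b = proj₁ (∧-split {inc b x} x-fixed-on-b)
      y∈b : inc b y ≡ true
      y∈b = proj₁ (∧-split {inc b y} y-fixed-on-b)
      sx≡x : s x ≡ x
      sx≡x = fixed-sound s x (proj₂ (∧-split {inc b x} x-fixed-on-b))
      sy≡y : s y ≡ y
      sy≡y = fixed-sound s y (proj₂ (∧-split {inc b y} y-fixed-on-b))
      invariant : Blocks.Invariant (λ c → inc c x ∧ inc c y)
      invariant c c∋xy = trans (cong₂ _∧_ (inc-β-fixed c x sx≡x) (inc-β-fixed c y sy≡y)) c∋xy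
      too-large : p ≤ count (λ c → inc c x ∧ inc c y)
      too-large = Blocks.orbit-≤ (λ c → inc c x ∧ inc c y) invariant b (cong₂ _∧_ x∈b y∈b)
                    (moved-sound β b (cong not b-moved))

  fixed-block-invariant : ∀ b → isFixed β b ≡ true → Points.Invariant (inc b)
  fixed-block-invariant b b-fixed x x∈b =
    trans (cong (λ c → inc c (s x)) (sym (fixed-sound β b b-fixed))) (trans (inc-β b x) x∈b)

  -- On a fixed block the moved points come in orbits of size p.
  fixed-block : ∀ b → isFixed β b ≡ true → Admissible p k (fixed-on b)
  fixed-block b b-fixed with Points.moved-part-divisible (inc b) (fixed-block-invariant b b-fixed)
  ... | divides q moved≡qp = q , (begin
    q * p + fixed-on b             ≡⟨ cong (_+ fixed-on b) moved≡qp ⟨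
    moved-on-b + fixed-on b        ≡⟨ +-comm moved-on-b (fixed-on b) ⟩
    fixed-on b + moved-on-b        ≡⟨ count-split (inc b) (isFixed s) ⟨
    count (inc b)                  ≡⟨ block-size b ⟩
    k                              ∎)
    where
    moved-on-b : ℕ
    moved-on-b = count (λ x → inc b x ∧ not (isFixed s x))

  -- The moved points come in orbits, so f ≡ v (mod p).
  some-fixed-point : ¬ p ∣ v → 0 < f
  some-fixed-point p∤v with 0 <? f
  ... | yes f>0 = f>0
  ... | no  f≯0 = contradiction (subst (p ∣_) moved≡v (Points.moved-part-divisible (λ _ → true) (λ _ _ → refl))) p∤v
    where
    moved≡v : count (not ∘ isFixed s) ≡ v
    moved≡v = trans (cong (_+ count (not ∘ isFixed s)) (sym (n≤0⇒n≡0 (≮⇒≥ f≯0)))) (count-compl (isFixed s))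

  some-moved-point : ¬ (∀ x → s x ≡ x) → f < v
  some-moved-point σ≉id with 0 <? count (not ∘ isFixed s)
  ... | yes moved>0 = subst (f <_) (count-compl (isFixed s)) (m<m+n f moved>0)
  ... | no  none    = contradiction all-fixed σ≉id
    where
    all-fixed : ∀ x → s x ≡ x
    all-fixed x with isFixed s x in x-fixed
    ... | true  = fixed-sound s x x-fixed
    ... | false = contradiction (count-pos {P = not ∘ isFixed s} x (cong not x-fixed)) none

  A B U : ℕ
  A = sum (λ b → χ (isFixed β b) * (fixed-on b * fixed-on b))
  B = sum (λ b → χ (isFixed β b) * fixed-on b)
  U = sum (λ b → χ (not (isFixed β b)) * fixed-on b)

  first-moment-split : B + U ≡ k * f
  first-moment-split = trans (sym (sum-split (isFixed β) fixed-on)) sum-fixed-on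

  second-moment-split : A + U ≡ f * (lam * f + (k ∸ lam))
  second-moment-split = begin
    A + U   ≡⟨ cong (A +_) (sum-cong-≗ moved-square) ⟨
    A + sum (λ b → χ (not (isFixed β b)) * (fixed-on b * fixed-on b))
            ≡⟨ sum-split (isFixed β) (λ b → fixed-on b * fixed-on b) ⟨
    sum (λ b → fixed-on b * fixed-on b) ≡⟨ sum-fixed-on² ⟩
    f * (lam * f + (k ∸ lam)) ∎
    where
    square-≤1 : ∀ {n} → n ≤ 1 → n * n ≡ n
    square-≤1 z≤n       = refl
    square-≤1 (s≤s z≤n) = refl
    moved-square : ∀ b → χ (not (isFixed β b)) * (fixed-on b * fixed-on b) ≡ χ (not (isFixed β b)) * fixed-on b
    moved-square b with isFixed β b in b-fixed
    ... | true  = refl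
    ... | false = cong (1 *_) (square-≤1 (moved-block b b-fixed))

  -- Moved blocks are v - f in number and carry at most one fixed point each.
  moved-blocks-bound : U + f ≤ v
  moved-blocks-bound = ≤-trans (+-monoˡ-≤ f (sum-mono at-most-one)) (≤-reflexive blocks-split)
    where
    at-most-one : ∀ b → χ (not (isFixed β b)) * fixed-on b ≤ χ (not (isFixed β b))
    at-most-one b with isFixed β b in b-fixed
    ... | true  = z≤n
    ... | false = ≤-trans (≤-reflexive (+-identityʳ (fixed-on b))) (moved-block b b-fixed)
    blocks-split : count (not ∘ isFixed β) + f ≡ v
    blocks-split = begin
      count (not ∘ isFixed β) + f                   ≡⟨ +-comm _ f ⟩
      f + count (not ∘ isFixed β)                   ≡⟨ cong (_+ count (not ∘ isFixed β)) fixed-points≡fixed-blocks ⟩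
      count (isFixed β) + count (not ∘ isFixed β)   ≡⟨ count-compl (isFixed β) ⟩
      v                                             ∎

  chord : ∀ M K → (∀ s → Admissible p k s → M * s ≤ s * s + K) → M * B ≤ A + K * f
  chord M K bound = ≤-trans (≤-reflexive (*-distribˡ-sum M (λ b → χ (isFixed β b) * fixed-on b)))
                            (≤-trans (sum-mono at-block) (≤-reflexive collect))
    where
    at-block : ∀ b → M * (χ (isFixed β b) * fixed-on b) ≤ χ (isFixed β b) * (fixed-on b * fixed-on b) + K * χ (isFixed β b)
    at-block b with isFixed β b in b-fixed
    ... | false = ≤-reflexive (trans (*-zeroʳ M) (sym (*-zeroʳ K)))
    ... | true  = subst₂ _≤_ (cong (M *_) (sym (+-identityʳ (fixed-on b))))
                             (cong₂ _+_ (sym (+-identityʳ _)) (sym (*-identityʳ K)))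
                             (bound (fixed-on b) (fixed-block b b-fixed))
    collect : sum (λ b → χ (isFixed β b) * (fixed-on b * fixed-on b) + K * χ (isFixed β b)) ≡ A + K * f
    collect = begin
      sum (λ b → χ (isFixed β b) * (fixed-on b * fixed-on b) + K * χ (isFixed β b))
        ≡⟨ ∑-distrib-+ (λ b → χ (isFixed β b) * (fixed-on b * fixed-on b)) (λ b → K * χ (isFixed β b)) ⟩
      A + sum (λ b → K * χ (isFixed β b))     ≡⟨ cong (A +_) (*-distribˡ-sum K (λ b → χ (isFixed β b))) ⟨
      A + K * count (isFixed β)               ≡⟨ cong (λ g → A + K * g) fixed-points≡fixed-blocks ⟨
      A + K * f                               ∎

  uniform : ∀ s₀ → (∀ s → Admissible p k s → s ≤ f → s ≡ s₀) → A ≡ s₀ * B × B ≡ s₀ * f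
  uniform s₀ only = A≡s₀B , B≡s₀f
    where
    at-fixed : ∀ b → isFixed β b ≡ true → fixed-on b ≡ s₀
    at-fixed b b-fixed = only (fixed-on b) (fixed-block b b-fixed) (count-mono (λ x → proj₂ ∘ ∧-split {inc b x}))
    square-term : ∀ b → χ (isFixed β b) * (fixed-on b * fixed-on b) ≡ s₀ * (χ (isFixed β b) * fixed-on b)
    square-term b with isFixed β b in b-fixed
    ... | false = sym (*-zeroʳ s₀)
    ... | true  rewrite at-fixed b b-fixed = trans (+-identityʳ (s₀ * s₀)) (cong (s₀ *_) (sym (+-identityʳ s₀)))
    linear-term : ∀ b → χ (isFixed β b) * fixed-on b ≡ s₀ * χ (isFixed β b)
    linear-term b with isFixed β b in b-fixed
    ... | false = sym (*-zeroʳ s₀)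
    ... | true  rewrite at-fixed b b-fixed = trans (+-identityʳ s₀) (sym (*-identityʳ s₀))
    A≡s₀B : A ≡ s₀ * B
    A≡s₀B = trans (sum-cong-≗ square-term) (sym (*-distribˡ-sum s₀ (λ b → χ (isFixed β b) * fixed-on b)))
    B≡s₀f : B ≡ s₀ * f
    B≡s₀f = trans (sum-cong-≗ linear-term) (trans (sym (*-distribˡ-sum s₀ (λ b → χ (isFixed β b))))
                                                   (cong (s₀ *_) (sym fixed-points≡fixed-blocks)))

below : ∀ {P : ℕ → Set} (P? : ∀ m → Dec (P m)) n → True (all? (λ (i : Fin n) → P? (toℕ i))) → ∀ m → m < n → P m
below {P} P? n verified m m<n = subst P (toℕ-fromℕ< m<n) (toWitness verified (fromℕ< m<n))

-- By PrimeOrder, f fixed points give A + U = f (3f + 13), B + U = 16 f and U ≤ 81 - f.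
-- If f ≤ bound, every fixed block carries the unique admissible value s₀ ≤ bound, so
-- A = s₀ B and B = s₀ f, contradicting small-f; otherwise the chord bound M s ≤ s² + K,
-- i.e. (s - a)(s - c) ≥ 0 for consecutive admissible a < c, contradicts large-f.
record Certificate (p : ℕ) : Set where
  field
    p-prime      : Prime p
    3<p          : 3 < p
    p∤81         : ¬ p ∣ 81
    M K bound s₀ : ℕ
    chord-bound  : ∀ s → Admissible p 16 s → M * s ≤ s * s + K
    only-s₀      : ∀ s → Admissible p 16 s → s ≤ bound → s ≡ s₀
    small-f      : ∀ f → 0 < f → f ≤ bound → s₀ * (s₀ * f) + 16 * f ≢ s₀ * f + f * (3 * f + 13)
    large-f      : ∀ f → bound < f → f < 81 → M * (16 * f) ≰ f * (3 * f + 13) + K * f + M * (81 ∸ f)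

no-automorphism-of-order : ∀ {p} → Certificate p → (D : SymmetricDesign 81 16 3) (σ : Permutation′ 81) →
  IsAutomorphism D σ → ¬ HasOrder σ p
no-automorphism-of-order cert D σ aut (_ , σᵖ≈id , minimal) = [ few-fixed-points , many-fixed-points ]′ (≤-<-connex f bound)
  where
  open Certificate cert
  open PrimeOrder D σ aut p-prime 3<p σᵖ≈id

  few-fixed-points : f ≤ bound → ⊥
  few-fixed-points f≤bound = small-f f (some-fixed-point p∤81) f≤bound (begin
    s₀ * (s₀ * f) + 16 * f    ≡⟨ cong₂ _+_ (trans (cong (s₀ *_) (sym B≡s₀f)) (sym A≡s₀B)) (sym first-moment-split) ⟩
    A + (B + U)               ≡⟨ x∙yz≈y∙xz A B U ⟩
    B + (A + U)               ≡⟨ cong₂ _+_ B≡s₀f second-moment-split ⟩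
    s₀ * f + f * (3 * f + 13) ∎)
    where
    uniformity : A ≡ s₀ * B × B ≡ s₀ * f
    uniformity = uniform s₀ (λ s admissible s≤f → only-s₀ s admissible (≤-trans s≤f f≤bound))
    A≡s₀B : A ≡ s₀ * B
    A≡s₀B = proj₁ uniformity
    B≡s₀f : B ≡ s₀ * f
    B≡s₀f = proj₂ uniformity

  many-fixed-points : bound < f → ⊥
  many-fixed-points bound<f = large-f f bound<f (some-moved-point σ≉id)
    (≤-trans (≤-reflexive expand)
             (+-mono-≤ (≤-trans (chord M K chord-bound) (+-monoˡ-≤ (K * f) A≤)) (*-monoʳ-≤ M U≤)))
    where
    expand : M * (16 * f) ≡ M * B + M * U
    expand = trans (cong (M *_) (sym first-moment-split)) (*-distribˡ-+ M B U)
    σ≉id : ¬ (∀ x → s x ≡ x)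
    σ≉id = minimal 1 (s≤s z≤n) (≤-trans (s≤s (s≤s z≤n)) (<⇒≤ 3<p))
    A≤ : A ≤ f * (3 * f + 13)
    A≤ = ≤-trans (m≤m+n A U) (≤-reflexive second-moment-split)
    U≤ : U ≤ 81 ∸ f
    U≤ = m+n≤o⇒m≤o∸n U moved-blocks-bound

-- p = 7: the admissible values are 16, 9 and 2, and (s - 9)(s - 16) ≥ 0 at each;
-- the conditions on f are checked by evaluation.
certificate₇ : Certificate 7
certificate₇ = record
  { p-prime     = from-yes (prime? 7)
  ; 3<p         = from-yes (3 <? 7)
  ; p∤81        = from-no (7 ∣? 81)
  ; M = 25 ; K = 144 ; bound = 8 ; s₀ = 2
  ; chord-bound = chord-bound
  ; only-s₀     = only-s₀
  ; small-f     = λ f f>0 f≤8 → below (λ f → 0 <? f →-dec ¬? (2 * (2 * f) + 16 * f ≟ℕ 2 * f + f * (3 * f + 13)))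
                                       9 _ f (s≤s f≤8) f>0
  ; large-f     = λ f 8<f f<81 → below (λ f → 8 <? f →-dec ¬? (25 * (16 * f) ≤? f * (3 * f + 13) + 144 * f + 25 * (81 ∸ f)))
                                        81 _ f f<81 8<f
  }
  where
  chord-bound : ∀ s → Admissible 7 16 s → 25 * s ≤ s * s + 144
  chord-bound s (0 , refl) = ≤ᵇ⇒≤ _ _ _
  chord-bound s (1 , refl) = ≤ᵇ⇒≤ _ _ _
  chord-bound s (2 , refl) = ≤ᵇ⇒≤ _ _ _
  only-s₀ : ∀ s → Admissible 7 16 s → s ≤ 8 → s ≡ 2
  only-s₀ s (0 , refl) 16≤8 = ⊥-elim (≤⇒≤ᵇ 16≤8)
  only-s₀ s (1 , refl) 9≤8  = ⊥-elim (≤⇒≤ᵇ 9≤8)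
  only-s₀ s (2 , refl) _    = refl

-- p = 11: the admissible values are 16 and 5, and (s - 5)(s - 16) ≥ 0 at each;
-- the conditions on f are checked by evaluation.
certificate₁₁ : Certificate 11
certificate₁₁ = record
  { p-prime     = from-yes (prime? 11)
  ; 3<p         = from-yes (3 <? 11)
  ; p∤81        = from-no (11 ∣? 81)
  ; M = 21 ; K = 80 ; bound = 7 ; s₀ = 5
  ; chord-bound = chord-bound
  ; only-s₀     = only-s₀
  ; small-f     = λ f f>0 f≤7 → below (λ f → 0 <? f →-dec ¬? (5 * (5 * f) + 16 * f ≟ℕ 5 * f + f * (3 * f + 13)))
                                       8 _ f (s≤s f≤7) f>0
  ; large-f     = λ f 7<f f<81 → below (λ f → 7 <? f →-dec ¬? (21 * (16 * f) ≤? f * (3 * f + 13) + 80 * f + 21 * (81 ∸ f)))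
                                        81 _ f f<81 7<f
  }
  where
  chord-bound : ∀ s → Admissible 11 16 s → 21 * s ≤ s * s + 80
  chord-bound s (0 , refl) = ≤ᵇ⇒≤ _ _ _
  chord-bound s (1 , refl) = ≤ᵇ⇒≤ _ _ _
  only-s₀ : ∀ s → Admissible 11 16 s → s ≤ 7 → s ≡ 5
  only-s₀ s (0 , refl) 16≤7 = ⊥-elim (≤⇒≤ᵇ 16≤7)
  only-s₀ s (1 , refl) _    = refl

lemma3p2 : (D : SymmetricDesign 81 16 3) (G : AutomorphismGroup D) →
    ∀ σ → mem G σ → (¬ HasOrder σ 7) × (¬ HasOrder σ 11)
lemma3p2 D G σ σ∈G = no-automorphism-of-order certificate₇ D σ aut , no-automorphism-of-order certificate₁₁ D σ aut
  where
  aut : IsAutomorphism D σ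
  aut = automorph G σ∈G
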